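{- Let $N$ be a natural number, $P=\{a\subseteq N:|a|\geq 2\}$, and let $n$ be a natural number. If $A\subseteq P$ can be split by $2^n$ sets, then $\|A\|_3\leq n$.
   Context: $N$ is identified with $\{0,\ldots,N-1\}$. For $A\subseteq P$ and $z\subseteq N$ let $A\restriction z=\{a\in A: a\subseteq z\}$. The graph coloring norm is defined recursively: $\|A\|_3\geq 0$ always; $\|A\|_3\geq 1$ iff $A\neq\emptyset$; for $n\geq 1$, $\|A\|_3\geq n+1$ iff for every $z\subseteq N$, either $\|A\restriction z\|_3\geq n$ or $\|A\restriction (N\setminus z)\|_3\geq n$; $\|A\|_3=n$ means $\|A\|_3\geq n$ but not $\|A\|_3\geq n+1$. For a partition $V_0,\ldots,V_{m-1}$ of $N$ (pairwise disjoint sets, possibly empty, with union $N$), $A$ is split by $V_0,\ldots,V_{m-1}$ if $A\restriction V_k=\emptyset$ for all $k<m$; $A$ can be split by $m$ sets if there is a partition of $N$ into $m$ sets splitting $A$. -}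

module Defs where

open import Data.Nat using (ℕ; zero; suc; _≤_; _^_)
open import Data.Fin using (Fin)
open import Data.Fin.Subset using (Subset; _⊆_; ∁; ∣_∣)
open import Data.Fin.Properties using (_≟_)
open import Data.Vec using (tabulate)
open import Data.Product using (_×_; ∃)
open import Data.Sum using (_⊎_)
open import Data.Unit using (⊤)
open import Data.Empty using (⊥)
open import Relation.Nullary using (¬_; does)

Family : ℕ → Set₁
Family N = Subset N → Set

⊆P : {N : ℕ} → Family N → Set
⊆P {N} A = ∀ (a : Subset N) → A a → 2 ≤ ∣ a ∣

_↾_ : {N : ℕ} → Family N → Subset N → Family N
(A ↾ z) a = A a × (a ⊆ z)

NonEmpty : {N : ℕ} → Family N → Set
NonEmpty A = ∃ λ a → A a

Norm3≥ : {N : ℕ} → ℕ → Family N → Set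
Norm3≥ zero A = ⊤
Norm3≥ (suc zero) A = NonEmpty A
Norm3≥ {N} (suc (suc n)) A =
  (z : Subset N) → Norm3≥ (suc n) (A ↾ z) ⊎ Norm3≥ (suc n) (A ↾ ∁ z)

Norm3≤ : {N : ℕ} → Family N → ℕ → Set
Norm3≤ A n = ¬ Norm3≥ (suc n) A

-- A partition V_0,…,V_{m-1} of N (pairwise disjoint, possibly empty, union N)
-- is represented by the map sending each element of N to the index of its block.
Partition : ℕ → ℕ → Set
Partition N m = Fin N → Fin m

block : {N m : ℕ} → Partition N m → Fin m → Subset N
block V k = tabulate (λ i → does (V i ≟ k))

SplitBy : {N m : ℕ} → Family N → Partition N m → Set
SplitBy A V = ∀ k a → ¬ (A ↾ block V k) a

CanBeSplit : {N : ℕ} → Family N → ℕ → Set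
CanBeSplit {N} A m = ∃ λ (V : Partition N m) → SplitBy A V

-- A partition into 2ⁿ parts splitting A is a colouring of N with 2ⁿ colours under which no member
-- of A is monochromatic. Induct on n: to refute ‖A‖₃ ≥ n + 1 it suffices to exhibit one z, and we
-- take z to be the points whose colour is below 2ⁿ⁻¹. The members inside z are then coloured with
-- 2ⁿ⁻¹ colours, and so are the members inside N ∖ z once their colours are shifted down by 2ⁿ⁻¹;
-- no member becomes monochromatic, so by induction both restrictions have norm at most n - 1.
module Submission where

open import Defs
open import Data.Nat using (ℕ; zero; suc; _+_; _∸_; _^_; _<_; _≤_; _<?_; NonZero)
open import Data.Nat.Properties using (n<1⇒n≡0; ≮⇒≥; m<n+o⇒m∸n<o; m∸n+n≡m; m^n≢0; n≮0; <⇒≤; +-identityʳ)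
open import Data.Fin using (Fin; toℕ)
open import Data.Fin.Properties using (toℕ<n; toℕ-injective; _≟_)
open import Data.Fin.Subset using (Subset; _∈_; ∁; ∣_∣; Nonempty)
open import Data.Fin.Subset.Properties using (x∈∁p⇒x∉p; nonempty?; Empty-unique; ∣⊥∣≡0)
open import Data.Vec using (tabulate)
open import Data.Vec.Properties using (lookup∘tabulate; []=⇒lookup; lookup⇒[]=)
open import Data.Product using (∃; _,_; proj₁)
open import Data.Sum using (inj₁; inj₂)
open import Function using (_∘_)
open import Level using (Level)
open import Relation.Nullary using (¬_; does; yes; no; contradiction)
open import Relation.Nullary.Decidable using (dec-true)
open import Relation.Unary using (Pred; Decidable)
open import Relation.Binary.PropositionalEquality using (_≡_; sym; trans; cong; subst)

private
  variable
    ℓ : Level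
    N : ℕ

satisfying : {P : Pred (Fin N) ℓ} → Decidable P → Subset N
satisfying P? = tabulate (does ∘ P?)

module _ {P : Pred (Fin N) ℓ} (P? : Decidable P) where

  ∈-satisfying⁺ : ∀ {i} → P i → i ∈ satisfying P?
  ∈-satisfying⁺ {i} p = lookup⇒[]= i _ (trans (lookup∘tabulate (does ∘ P?) i) (dec-true (P? i) p))

  ∈-satisfying⁻ : ∀ {i} → i ∈ satisfying P? → P i
  ∈-satisfying⁻ {i} i∈ with P? i | trans (sym (lookup∘tabulate (does ∘ P?) i)) ([]=⇒lookup i∈)
  ... | yes p | _ = p
  ... | no _  | ()

  ∈∁-satisfying⁻ : ∀ {i} → i ∈ ∁ (satisfying P?) → ¬ P i
  ∈∁-satisfying⁻ i∈∁ = x∈∁p⇒x∉p i∈∁ ∘ ∈-satisfying⁺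

0<∣p∣⇒Nonempty : {p : Subset N} → 0 < ∣ p ∣ → Nonempty p
0<∣p∣⇒Nonempty {N} {p} 0<∣p∣ with nonempty? p
... | yes ne = ne
... | no empty = contradiction (subst (0 <_) ∣p∣≡0 0<∣p∣) n≮0
  where
  ∣p∣≡0 : ∣ p ∣ ≡ 0
  ∣p∣≡0 = trans (cong ∣_∣ (Empty-unique empty)) (∣⊥∣≡0 N)

Colouring : ℕ → Set
Colouring N = Fin N → ℕ

ColoursBelow : Family N → Colouring N → ℕ → Set
ColoursBelow A c m = ∀ {a} → A a → ∀ {i} → i ∈ a → c i < m

Monochromatic : Colouring N → Subset N → Set
Monochromatic c a = ∃ λ k → ∀ {i} → i ∈ a → c i ≡ k

NoneMonochromatic : Family N → Colouring N → Set
NoneMonochromatic A c = ∀ {a} → A a → ¬ Monochromatic c a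

monochromatic-∸ : ∀ {c : Colouring N} {a} m → (∀ {i} → i ∈ a → m ≤ c i) →
                  Monochromatic (λ i → c i ∸ m) a → Monochromatic c a
monochromatic-∸ m m≤c (k , c∸m≡k) =
  k + m , λ i∈a → trans (sym (m∸n+n≡m (m≤c i∈a))) (cong (_+ m) (c∸m≡k i∈a))

lowColours : Colouring N → ℕ → Subset N
lowColours c m = satisfying (λ i → c i <? m)

module _ {A : Family N} {c : Colouring N} (m : ℕ) where

  coloursBelow-↾lowColours : ColoursBelow (A ↾ lowColours c m) c m
  coloursBelow-↾lowColours (_ , a⊆low) i∈a = ∈-satisfying⁻ (λ i → c i <? m) (a⊆low i∈a)

  coloursAbove-↾∁lowColours : ∀ {a} → (A ↾ ∁ (lowColours c m)) a → ∀ {i} → i ∈ a → m ≤ c i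
  coloursAbove-↾∁lowColours (_ , a⊆high) i∈a = ≮⇒≥ (∈∁-satisfying⁻ (λ i → c i <? m) (a⊆high i∈a))

  coloursBelow-↾∁lowColours : .{{NonZero m}} → ColoursBelow A c (m + m) →
                              ColoursBelow (A ↾ ∁ (lowColours c m)) (λ i → c i ∸ m) m
  coloursBelow-↾∁lowColours below (Aa , _) {i} i∈a = m<n+o⇒m∸n<o (c i) m (below Aa i∈a)

  noneMonochromatic-↾∁lowColours : NoneMonochromatic A c →
                                   NoneMonochromatic (A ↾ ∁ (lowColours c m)) (λ i → c i ∸ m)
  noneMonochromatic-↾∁lowColours none A↾a =
    none (proj₁ A↾a) ∘ monochromatic-∸ m (coloursAbove-↾∁lowColours A↾a)

noneMonochromatic⇒Norm3≤ : ∀ n {A : Family N} (c : Colouring N) →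
  ColoursBelow A c (2 ^ n) → NoneMonochromatic A c → Norm3≤ A n
noneMonochromatic⇒Norm3≤ zero c below none (a , Aa) =
  none Aa (0 , λ i∈a → n<1⇒n≡0 (below Aa i∈a))
noneMonochromatic⇒Norm3≤ (suc n) {A} c below none norm with norm (lowColours c (2 ^ n))
... | inj₁ normLow = noneMonochromatic⇒Norm3≤ n {A ↾ _} c
  (coloursBelow-↾lowColours {A = A} (2 ^ n)) (none ∘ proj₁) normLow
... | inj₂ normHigh = noneMonochromatic⇒Norm3≤ n {A ↾ ∁ _} (λ i → c i ∸ 2 ^ n)
  (coloursBelow-↾∁lowColours (2 ^ n) {{m^n≢0 2 n}} (subst (ColoursBelow A c) 2ⁿ⁺¹≡2ⁿ+2ⁿ below))
  (noneMonochromatic-↾∁lowColours (2 ^ n) none) normHigh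
  where
  2ⁿ⁺¹≡2ⁿ+2ⁿ : 2 ^ suc n ≡ 2 ^ n + 2 ^ n
  2ⁿ⁺¹≡2ⁿ+2ⁿ = cong (2 ^ n +_) (+-identityʳ (2 ^ n))

splitBy⇒noneMonochromatic : ∀ {m} {A : Family N} {V : Partition N m} →
                             ⊆P A → SplitBy A V → NoneMonochromatic A (toℕ ∘ V)
splitBy⇒noneMonochromatic {V = V} ⊆P-A split {a} Aa (k , V≡k)
  with 0<∣p∣⇒Nonempty (<⇒≤ (⊆P-A a Aa))
... | j , j∈a = split (V j) a (Aa , λ i∈a →
      ∈-satisfying⁺ (λ i → V i ≟ V j) (toℕ-injective (trans (V≡k i∈a) (sym (V≡k j∈a)))))

mainTheorem5 : (N : ℕ) (A : Family N) → ⊆P A → (n : ℕ)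
    → CanBeSplit A (2 ^ n) → Norm3≤ A n
mainTheorem5 N A ⊆P-A n (V , split) =
  noneMonochromatic⇒Norm3≤ n (toℕ ∘ V) (λ _ _ → toℕ<n _) (splitBy⇒noneMonochromatic ⊆P-A split)
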